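{- Let $m$ be a positive integer, let $v$ be an integral vector with $v\not\equiv0\pmod m$, and let $w$ be the shortest $m$-representative of $v$. If $v$ has at least one perfect $m$-representative, then $w^Tw\le m^2$ and $|e^Tw-m|\le 3m$.
   Context: Let $e$ be the all-ones vector. For a positive integer $m$ and an integral vector $v$, an integral vector $w$ is a perfect $m$-representative of $v$ if $w\equiv v\pmod m$ (entrywise), $e^Tw=m$ and $w^Tw=m^2$. The shortest $m$-representative of $v$ is the unique integral vector $u$ with $u\equiv v\pmod m$ and $-m/2<u_i\le m/2$ for all $i$. -}

module Defs where

open import Data.Nat using (ℕ)
open import Data.Integer using (ℤ; +_; _+_; _-_; _*_; -_; _<_; _≤_; ∣_∣)
open import Data.Integer.Divisibility using (_∣_)
open import Data.Vec using (Vec; foldr; zipWith)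
open import Data.Vec.Relation.Unary.All using (All)
open import Data.Vec.Relation.Binary.Pointwise.Inductive using (Pointwise)
open import Relation.Nullary using (¬_)

eᵀ : ∀ {n} → Vec ℤ n → ℤ
eᵀ = foldr _ _+_ (+ 0)

⟨_,_⟩ : ∀ {n} → Vec ℤ n → Vec ℤ n → ℤ
⟨ u , v ⟩ = eᵀ (zipWith _*_ u v)

_≡_[mod_] : ∀ {n} → Vec ℤ n → Vec ℤ n → ℕ → Set
u ≡ v [mod m ] = Pointwise (λ a b → (+ m) ∣ (a - b)) u v

≡0[mod_] : ∀ {n} → ℕ → Vec ℤ n → Set
≡0[mod m ] v = All (λ a → (+ m) ∣ a) v

PerfectRep : ∀ {n} → ℕ → Vec ℤ n → Vec ℤ n → Set
PerfectRep m v w = (w ≡ v [mod m ]) × (eᵀ w ≡ᶻ + m) × (⟨ w , w ⟩ ≡ᶻ (+ m) * (+ m))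
  where
  open import Data.Product using (_×_)
  open import Relation.Binary.PropositionalEquality renaming (_≡_ to _≡ᶻ_)

-- u is the shortest m-representative of v:
-- u ≡ v (mod m) and -m/2 < u_i ≤ m/2, written as -m < 2 u_i ≤ m
ShortestRep : ∀ {n} → ℕ → Vec ℤ n → Vec ℤ n → Set
ShortestRep m v u = (u ≡ v [mod m ]) × All (λ a → (- (+ m) < (+ 2) * a) × ((+ 2) * a ≤ + m)) u
  where
  open import Data.Product using (_×_)

{-# OPTIONS --safe #-}
-- Let p be a perfect m-representative of v and write M = m.  Entrywise, b = a - k M
-- where a is the entry of the shortest representative w, so -M < 2a ≤ M.  Then
-- a² ≤ b², and k is controlled by b: for k ≥ 1 we have -2b ≥ k M, and for k ≤ -1
-- we have 2b ≥ |k| (M + 1), so that, as 4(b² ∓ b) = (∓2b)(∓2b + 2),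
--   k M (M + 2) ≤ 4 (b² - b)    and    -k (M + 1) (M + 3) ≤ 4 (b² + b).
-- Summing over the entries, with Σ b² = M², Σ b = M and K = Σ k, gives
-- wᵀw ≤ M², K M (M + 2) ≤ 4 (M² - M) and -K (M + 1)(M + 3) ≤ 4 (M² + M), so
-- |K| ≤ 3; and eᵀw - M = K M.
module Submission where

open import Data.Nat as ℕ using (ℕ; NonZero; s≤s; z≤n)
import Data.Nat.Properties as ℕ
open import Data.Integer hiding (NonZero)
open import Data.Integer.Properties
open import Data.Integer.Divisibility.Signed using (_∣_; divides; ∣ᵤ⇒∣; ∣m∣n⇒∣m-n)
open import Data.Integer.Tactic.RingSolver using (solve; solve-∀)
open import Data.List using ([]; _∷_)
open import Data.Product using (Σ; _×_; _,_)
open import Data.Vec using (Vec)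
open import Function using (_∘_)
open import Relation.Binary.PropositionalEquality using (_≡_; refl; sym; cong; subst)
open import Relation.Nullary using (¬_)

open import Defs

open ≤-Reasoning

0≤i*j : ∀ {i j} → 0ℤ ≤ i → 0ℤ ≤ j → 0ℤ ≤ i * j
0≤i*j {i} {j} 0≤i 0≤j = begin
  0ℤ     ≡⟨ *-zeroʳ i ⟨
  i * 0ℤ ≤⟨ *-monoˡ-≤-nonNeg i {{nonNegative 0≤i}} 0≤j ⟩
  i * j  ∎

i*j≤0 : ∀ {i j} → i ≤ 0ℤ → 0ℤ ≤ j → i * j ≤ 0ℤ
i*j≤0 {i} {j} i≤0 0≤j = *-monoʳ-≤-nonNeg j {{nonNegative 0≤j}} i≤0

*-mono-≤-nonNeg : ∀ {i j k l} → 0ℤ ≤ i → 0ℤ ≤ k → i ≤ j → k ≤ l → i * k ≤ j * l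
*-mono-≤-nonNeg {i} {j} {k} {l} 0≤i 0≤k i≤j k≤l = begin
  i * k ≤⟨ *-monoʳ-≤-nonNeg k {{nonNegative 0≤k}} i≤j ⟩
  j * k ≤⟨ *-monoˡ-≤-nonNeg j {{nonNegative (≤-trans 0≤i i≤j)}} k≤l ⟩
  j * l ∎

i≤k*i : ∀ {i k} → 0ℤ ≤ i → + 1 ≤ k → i ≤ k * i
i≤k*i {i} {k} 0≤i 1≤k = begin
  i       ≡⟨ *-identityˡ i ⟨
  + 1 * i ≤⟨ *-monoʳ-≤-nonNeg i {{nonNegative 0≤i}} 1≤k ⟩
  k * i   ∎

0≤i*[1+i] : ∀ i → 0ℤ ≤ i * (+ 1 + i)
0≤i*[1+i] i@(+ _)      = 0≤i*j {i} {+ 1 + i} (+≤+ z≤n) (+≤+ z≤n)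
0≤i*[1+i] i@(-[1+ _ ]) = begin
  0ℤ            ≡⟨ *-zeroʳ i ⟨
  i * 0ℤ        ≤⟨ *-monoˡ-≤-nonPos i (i<j⇒suc[i]≤j {i} {0ℤ} -<+) ⟩
  i * (+ 1 + i) ∎

0≤4*[i*i+i] : ∀ i → 0ℤ ≤ + 4 * (i * i + i)
0≤4*[i*i+i] i = begin
  0ℤ                    ≤⟨ 0≤i*j {+ 4} (+≤+ z≤n) (0≤i*[1+i] i) ⟩
  + 4 * (i * (+ 1 + i)) ≡⟨ solve (i ∷ []) ⟩
  + 4 * (i * i + i)     ∎

0≤4*[i*i-i] : ∀ i → 0ℤ ≤ + 4 * (i * i - i)
0≤4*[i*i-i] i = begin
  0ℤ                      ≤⟨ 0≤4*[i*i+i] (- i) ⟩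
  + 4 * (- i * - i + - i) ≡⟨ solve (i ∷ []) ⟩
  + 4 * (i * i - i)       ∎

∣i∣<n : ∀ {i n} → i < + n → - i < + n → ∣ i ∣ ℕ.< n
∣i∣<n {+ _}       (+<+ i<n) _         = i<n
∣i∣<n { -[1+ _ ]} _         (+<+ i<n) = i<n

common-residue⇒shift : ∀ {M a b c} → M ∣ (a - c) → M ∣ (b - c) → Σ ℤ λ k → b ≡ a - k * M
common-residue⇒shift {M} {a} {b} {c} M∣a-c M∣b-c with ∣m∣n⇒∣m-n M∣a-c M∣b-c
... | divides k a-c-[b-c]≡kM = k , (begin-equality
  b                       ≡⟨ solve (a ∷ b ∷ c ∷ []) ⟩
  a - ((a - c) - (b - c)) ≡⟨ cong (_-_ a) a-c-[b-c]≡kM ⟩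
  a - k * M               ∎)

-- s, t, e and k stand for Σ aᵢ², Σ bᵢ², Σ bᵢ and Σ kᵢ, where bᵢ = aᵢ - kᵢ M.
record Estimates (M s t e k : ℤ) : Set where
  field
    sq-≤  : s ≤ t
    upper : k * (M * (M + + 2)) ≤ + 4 * (t - e)
    lower : (- k) * ((M + + 1) * (M + + 3)) ≤ + 4 * (t + e)

open Estimates

module _ {M : ℤ} where

  Estimates-0 : Estimates M 0ℤ 0ℤ 0ℤ 0ℤ
  Estimates-0 = record { sq-≤ = ≤-refl ; upper = ≤-refl ; lower = ≤-refl }

  Estimates-+ : ∀ {s t e k s′ t′ e′ k′} → Estimates M s t e k → Estimates M s′ t′ e′ k′ →
                Estimates M (s + s′) (t + t′) (e + e′) (k + k′)
  Estimates-+ {s} {t} {e} {k} {s′} {t′} {e′} {k′} E E′ = record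
    { sq-≤  = +-mono-≤ (sq-≤ E) (sq-≤ E′)
    ; upper = begin
        (k + k′) * (M * (M + + 2))                 ≡⟨ *-distribʳ-+ (M * (M + + 2)) k k′ ⟩
        k * (M * (M + + 2)) + k′ * (M * (M + + 2)) ≤⟨ +-mono-≤ (upper E) (upper E′) ⟩
        + 4 * (t - e) + + 4 * (t′ - e′)            ≡⟨ solve (t ∷ e ∷ t′ ∷ e′ ∷ []) ⟩
        + 4 * ((t + t′) - (e + e′))                ∎
    ; lower = begin
        (- (k + k′)) * ((M + + 1) * (M + + 3))
          ≡⟨ solve (k ∷ k′ ∷ M ∷ []) ⟩
        (- k) * ((M + + 1) * (M + + 3)) + (- k′) * ((M + + 1) * (M + + 3))
          ≤⟨ +-mono-≤ (lower E) (lower E′) ⟩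
        + 4 * (t + e) + + 4 * (t′ + e′)
          ≡⟨ solve (t ∷ e ∷ t′ ∷ e′ ∷ []) ⟩
        + 4 * ((t + t′) + (e + e′))
          ∎
    }

module _ {M : ℤ} (1≤M : + 1 ≤ M) where

  private
    0≤M : 0ℤ ≤ M
    0≤M = ≤-trans (+≤+ z≤n) 1≤M

    0≤M+n : ∀ n → 0ℤ ≤ M + + n
    0≤M+n n = ≤-trans 0≤M (i≤i+j M (+ n))

    0≤M[M+2] : 0ℤ ≤ M * (M + + 2)
    0≤M[M+2] = 0≤i*j 0≤M (0≤M+n 2)

    0≤[M+1][M+3] : 0ℤ ≤ (M + + 1) * (M + + 3)
    0≤[M+1][M+3] = 0≤i*j (0≤M+n 1) (0≤M+n 3)

  estimates⁺ : ∀ a k → + 1 ≤ k → + 2 * a ≤ M →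
               let b = a - k * M in Estimates M (a * a) (b * b) b k
  estimates⁺ a k 1≤k 2a≤M = record
    { sq-≤  = begin
        a * a                             ≡⟨ +-identityʳ (a * a) ⟨
        a * a + 0ℤ                        ≤⟨ +-monoʳ-≤ (a * a) (0≤i*j 0≤kM 0≤kM-2a) ⟩
        a * a + k * M * (k * M - + 2 * a) ≡⟨ solve (a ∷ k ∷ M ∷ []) ⟩
        (a - k * M) * (a - k * M)         ∎
    ; upper = begin
        k * (M * (M + + 2))
          ≡⟨ solve (k ∷ M ∷ []) ⟩
        k * M * (M + + 2)
          ≤⟨ *-mono-≤-nonNeg 0≤kM (0≤M+n 2) kM≤2[kM-a]
                             (+-monoˡ-≤ (+ 2) (≤-trans M≤kM kM≤2[kM-a])) ⟩
        + 2 * (k * M - a) * (+ 2 * (k * M - a) + + 2)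
          ≡⟨ solve (a ∷ k ∷ M ∷ []) ⟩
        + 4 * ((a - k * M) * (a - k * M) - (a - k * M))
          ∎
    ; lower = begin
        (- k) * ((M + + 1) * (M + + 3))
          ≤⟨ i*j≤0 (neg-mono-≤ (≤-trans (+≤+ z≤n) 1≤k)) 0≤[M+1][M+3] ⟩
        0ℤ
          ≤⟨ 0≤4*[i*i+i] (a - k * M) ⟩
        + 4 * ((a - k * M) * (a - k * M) + (a - k * M))
          ∎
    }
    where
    M≤kM : M ≤ k * M
    M≤kM = i≤k*i 0≤M 1≤k
    0≤kM : 0ℤ ≤ k * M
    0≤kM = ≤-trans 0≤M M≤kM
    0≤kM-2a : 0ℤ ≤ k * M - + 2 * a
    0≤kM-2a = i≤j⇒0≤j-i (≤-trans 2a≤M M≤kM)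
    kM≤2[kM-a] : k * M ≤ + 2 * (k * M - a)
    kM≤2[kM-a] = begin
      k * M                     ≤⟨ i≤i+j (k * M) (k * M - + 2 * a) {{nonNegative 0≤kM-2a}} ⟩
      k * M + (k * M - + 2 * a) ≡⟨ solve (a ∷ k ∷ M ∷ []) ⟩
      + 2 * (k * M - a)         ∎

  estimates⁻ : ∀ a l → + 1 ≤ l → - M < + 2 * a →
               let b = a - (- l) * M in Estimates M (a * a) (b * b) b (- l)
  estimates⁻ a l 1≤l -M<2a = record
    { sq-≤  = begin
        a * a                             ≡⟨ +-identityʳ (a * a) ⟨
        a * a + 0ℤ                        ≤⟨ +-monoʳ-≤ (a * a) (0≤i*j 0≤lM 0≤lM+2a) ⟩
        a * a + l * M * (l * M + + 2 * a) ≡⟨ solve (a ∷ l ∷ M ∷ []) ⟩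
        (a - (- l) * M) * (a - (- l) * M) ∎
    ; upper = begin
        (- l) * (M * (M + + 2))
          ≤⟨ i*j≤0 (neg-mono-≤ (≤-trans (+≤+ z≤n) 1≤l)) 0≤M[M+2] ⟩
        0ℤ
          ≤⟨ 0≤4*[i*i-i] (a - (- l) * M) ⟩
        + 4 * ((a - (- l) * M) * (a - (- l) * M) - (a - (- l) * M))
          ∎
    ; lower = begin
        (- (- l)) * ((M + + 1) * (M + + 3))
          ≡⟨ solve (l ∷ M ∷ []) ⟩
        l * (M + + 1) * (M + + 3)
          ≤⟨ *-mono-≤-nonNeg (0≤i*j (≤-trans (+≤+ z≤n) 1≤l) (0≤M+n 1)) (0≤M+n 3)
                             l[M+1]≤2[a+lM] M+3≤2[a+lM]+2 ⟩
        + 2 * (a + l * M) * (+ 2 * (a + l * M) + + 2)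
          ≡⟨ solve (a ∷ l ∷ M ∷ []) ⟩
        + 4 * ((a - (- l) * M) * (a - (- l) * M) + (a - (- l) * M))
          ∎
    }
    where
    1-M≤2a : + 1 + - M ≤ + 2 * a
    1-M≤2a = i<j⇒suc[i]≤j -M<2a
    M≤lM : M ≤ l * M
    M≤lM = i≤k*i 0≤M 1≤l
    0≤lM : 0ℤ ≤ l * M
    0≤lM = ≤-trans 0≤M M≤lM
    0≤lM+2a : 0ℤ ≤ l * M + + 2 * a
    0≤lM+2a = begin
      0ℤ              ≤⟨ i≤j⇒0≤j-i (<⇒≤ -M<2a) ⟩
      + 2 * a - - M   ≡⟨ solve (a ∷ M ∷ []) ⟩
      M + + 2 * a     ≤⟨ +-monoˡ-≤ (+ 2 * a) M≤lM ⟩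
      l * M + + 2 * a ∎
    -- l ≤ (l - 1) M + 1 is where M ≥ 1 is needed.
    l[M+1]≤2[a+lM] : l * (M + + 1) ≤ + 2 * (a + l * M)
    l[M+1]≤2[a+lM] = begin
      l * (M + + 1)
        ≡⟨ solve (l ∷ M ∷ []) ⟩
      (l - + 1) * + 1 + (l * M + + 1)
        ≤⟨ +-monoˡ-≤ (l * M + + 1)
                     (*-monoˡ-≤-nonNeg (l - + 1) {{nonNegative (i≤j⇒0≤j-i 1≤l)}} 1≤M) ⟩
      (l - + 1) * M + (l * M + + 1)
        ≡⟨ solve (l ∷ M ∷ []) ⟩
      l * M + (l * M + (+ 1 + - M))
        ≤⟨ +-monoʳ-≤ (l * M) (+-monoʳ-≤ (l * M) 1-M≤2a) ⟩
      l * M + (l * M + + 2 * a)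
        ≡⟨ solve (a ∷ l ∷ M ∷ []) ⟩
      + 2 * (a + l * M)
        ∎
    M+3≤2[a+lM]+2 : M + + 3 ≤ + 2 * (a + l * M) + + 2
    M+3≤2[a+lM]+2 = begin
      M + + 3                 ≡⟨ +-assoc M (+ 1) (+ 2) ⟨
      M + + 1 + + 2           ≤⟨ +-monoˡ-≤ (+ 2) (≤-trans (i≤k*i (0≤M+n 1) 1≤l) l[M+1]≤2[a+lM]) ⟩
      + 2 * (a + l * M) + + 2 ∎

  entry-estimates : ∀ a k → - M < + 2 * a → + 2 * a ≤ M →
                    let b = a - k * M in Estimates M (a * a) (b * b) b k
  entry-estimates a +0 _ _ =
    subst (λ b → Estimates M (a * a) (b * b) b 0ℤ) (sym (+-identityʳ a)) record
      { sq-≤  = ≤-refl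
      ; upper = 0≤4*[i*i-i] a
      ; lower = 0≤4*[i*i+i] a
      }
  entry-estimates a k@(+[1+ _ ]) _      2a≤M = estimates⁺ a k (+≤+ (s≤s z≤n)) 2a≤M
  entry-estimates a -[1+ j ]     -M<2a _    = estimates⁻ a +[1+ j ] (+≤+ (s≤s z≤n)) -M<2a

  ∣k∣≤3 : ∀ {s k} → Estimates M s (M * M) M k → ∣ k ∣ ℕ.≤ 3
  ∣k∣≤3 {s} {k} E = ℕ.s≤s⁻¹ (∣i∣<n k<4 -k<4)
    where
    0<12M : 0ℤ < + 12 * M
    0<12M = *-monoˡ-<-pos (+ 12) {0ℤ} (suc[i]≤j⇒i<j 1≤M)
    k<4 : k < + 4
    k<4 = *-cancelʳ-<-nonNeg (M * (M + + 2)) {{nonNegative 0≤M[M+2]}} (begin-strict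
      k * (M * (M + + 2))          ≤⟨ upper E ⟩
      + 4 * (M * M - M)            ≡⟨ +-identityʳ _ ⟨
      + 4 * (M * M - M) + 0ℤ       <⟨ +-monoʳ-< (+ 4 * (M * M - M)) 0<12M ⟩
      + 4 * (M * M - M) + + 12 * M ≡⟨ solve (M ∷ []) ⟩
      + 4 * (M * (M + + 2))        ∎)
    -k<4 : - k < + 4
    -k<4 = *-cancelʳ-<-nonNeg ((M + + 1) * (M + + 3)) {{nonNegative 0≤[M+1][M+3]}} (begin-strict
      (- k) * ((M + + 1) * (M + + 3))     ≤⟨ lower E ⟩
      + 4 * (M * M + M)                   ≡⟨ +-identityʳ _ ⟨
      + 4 * (M * M + M) + 0ℤ              <⟨ +-monoʳ-< (+ 4 * (M * M + M)) 0<12M ⟩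
      + 4 * (M * M + M) + + 12 * M        ≤⟨ i≤i+j _ (+ 12) ⟩
      + 4 * (M * M + M) + + 12 * M + + 12 ≡⟨ solve (M ∷ []) ⟩
      + 4 * ((M + + 1) * (M + + 3))       ∎)

module _ (m : ℕ) .{{_ : NonZero m}} where
  -- Imported only here, so that the list syntax of the ring solver above stays unambiguous.
  open import Data.Vec using ([]; _∷_)
  open import Data.Vec.Relation.Unary.All using ([]; _∷_)
  open import Data.Vec.Relation.Binary.Pointwise.Inductive using ([]; _∷_)

  shortestRep-estimates : ∀ {n} {v w p : Vec ℤ n} → ShortestRep m v w → p ≡ v [mod m ] →
    Σ ℤ λ K → (eᵀ w - eᵀ p ≡ K * + m) × Estimates (+ m) ⟨ w , w ⟩ ⟨ p , p ⟩ (eᵀ p) K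
  shortestRep-estimates ([] , []) [] = 0ℤ , refl , Estimates-0
  shortestRep-estimates {v = c ∷ _} {a ∷ w} {b ∷ p}
                        (a≡c ∷ w≡v , (-m<2a , 2a≤m) ∷ centred) (b≡c ∷ p≡v)
    with common-residue⇒shift {+ m} {a} {b} {c} (∣ᵤ⇒∣ a≡c) (∣ᵤ⇒∣ b≡c)
       | shortestRep-estimates (w≡v , centred) p≡v
  ... | k , refl | K , eᵀw-eᵀp≡Km , E =
    k + K , eᵀ-difference , Estimates-+ (entry-estimates (+≤+ (ℕ.>-nonZero⁻¹ m)) a k -m<2a 2a≤m) E
    where
    regroup : ∀ a W P x → (a + W) - (a - x + P) ≡ x + (W - P)
    regroup = solve-∀
    eᵀ-difference : (a + eᵀ w) - (a - k * + m + eᵀ p) ≡ (k + K) * + m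
    eᵀ-difference = begin-equality
      (a + eᵀ w) - (a - k * + m + eᵀ p) ≡⟨ regroup a (eᵀ w) (eᵀ p) (k * + m) ⟩
      k * + m + (eᵀ w - eᵀ p)           ≡⟨ cong (_+_ (k * + m)) eᵀw-eᵀp≡Km ⟩
      k * + m + K * + m                 ≡⟨ *-distribʳ-+ (+ m) k K ⟨
      (k + K) * + m                     ∎

corollary4 : (m : ℕ) → .{{_ : NonZero m}} → (n : ℕ) → (v w : Vec ℤ n)
    → ¬ (≡0[mod m ] v)
    → ShortestRep m v w
    → Σ (Vec ℤ n) (λ w′ → PerfectRep m v w′)
    → (⟨ w , w ⟩ ≤ (+ m) * (+ m)) × (+ ∣ eᵀ w - + m ∣ ≤ (+ 3) * (+ m))
corollary4 m n v w _ shortest (p , p≡v , eᵀp≡m , ⟨p,p⟩≡m²)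
  with shortestRep-estimates m shortest p≡v
... | K , eᵀw-eᵀp≡Km , E rewrite eᵀp≡m | ⟨p,p⟩≡m² = sq-≤ E , (begin
  + ∣ eᵀ w - + m ∣ ≡⟨ cong (+_ ∘ ∣_∣) eᵀw-eᵀp≡Km ⟩
  + ∣ K * + m ∣    ≡⟨ cong +_ (abs-* K (+ m)) ⟩
  + (∣ K ∣ ℕ.* m)  ≤⟨ +≤+ (ℕ.*-monoˡ-≤ m (∣k∣≤3 (+≤+ (ℕ.>-nonZero⁻¹ m)) E)) ⟩
  + (3 ℕ.* m)      ≡⟨ pos-* 3 m ⟩
  + 3 * + m        ∎)
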